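{- For every integer $N\ge1$, with $\mathbf t=(1,\infty,1,\infty,\ldots,1,\infty)\in\overline{\mathbb N}_+^{2N}$ (all $k_j=1$, all $\ell_j=\infty$), we have \[ c_{\mathbf t}=\frac12+\frac1{4^N}\binom{2N-1}{N}. \]
   Context: Let $\overline{\mathbb N}_+=\{1,2,3,\ldots\}\cup\{\infty\}$. Let $\alpha,\beta$ be formal variables, $A_0=\begin{pmatrix}1&0\\ \alpha&\beta\end{pmatrix}$, $A_1=\begin{pmatrix}\alpha&\beta\\0&1\end{pmatrix}$ over $\mathbb C[[\alpha,\beta]]$, with usual powers for finite exponents and $A_0^\infty=\begin{pmatrix}1&0\\ \frac{\alpha}{1-\beta}&0\end{pmatrix}$, $A_1^\infty=\begin{pmatrix}0&\frac{\beta}{1-\alpha}\\0&1\end{pmatrix}$. For $\mathbf t=(k_0,\ell_0,\ldots,k_{N-1},\ell_{N-1})\in\overline{\mathbb N}_+^{2N}$, $\gamma_{\mathbf t}(\alpha,\beta)$ is the top-left entry of $A_1^{k_0}A_0^{\ell_0}\cdots A_1^{k_{N-1}}A_0^{\ell_{N-1}}$ and $c_{\mathbf t}=\sum_{i\ge j\ge0}2^{ -(i+j)}[\alpha^i\beta^j]\gamma_{\mathbf t}(\alpha,\beta)$. -}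

module Defs where

open import Data.Nat as ℕ using (ℕ; zero; suc; _∸_; _≤_)
open import Data.Nat.Combinatorics using (_C_)
open import Data.Integer using (+_)
open import Data.Rational using (ℚ; 0ℚ; 1ℚ; _+_; _*_; _-_; ∣_∣; _<_; _/_; ½)
open import Data.Product using (_×_; _,_; ∃-syntax)
open import Data.Vec using (Vec; []; _∷_; replicate)

sumTo : ℕ → (ℕ → ℚ) → ℚ
sumTo zero    f = f 0
sumTo (suc n) f = sumTo n f + f (suc n)

_^ℚ_ : ℚ → ℕ → ℚ
q ^ℚ zero  = 1ℚ
q ^ℚ suc n = q * (q ^ℚ n)

-- Formal power series in α, β over ℚ:  f i j = [α^i β^j] f
PS : Set
PS = ℕ → ℕ → ℚ

0ps 1ps αps βps : PS
0ps i j = 0ℚ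
1ps zero zero = 1ℚ
1ps _    _    = 0ℚ
αps 1 0 = 1ℚ
αps _ _ = 0ℚ
βps 0 1 = 1ℚ
βps _ _ = 0ℚ

α/1-β : PS
α/1-β 1 j = 1ℚ
α/1-β _ _ = 0ℚ

β/1-α : PS
β/1-α i 1 = 1ℚ
β/1-α _ _ = 0ℚ

_⊕_ : PS → PS → PS
(f ⊕ g) i j = f i j + g i j

_⊛_ : PS → PS → PS
(f ⊛ g) i j = sumTo i λ a → sumTo j λ b → f a b * g (i ∸ a) (j ∸ b)

record M2 : Set where
  constructor mat
  field a b c d : PS
open M2 public

_·_ : M2 → M2 → M2
mat a₁ b₁ c₁ d₁ · mat a₂ b₂ c₂ d₂ =
  mat ((a₁ ⊛ a₂) ⊕ (b₁ ⊛ c₂)) ((a₁ ⊛ b₂) ⊕ (b₁ ⊛ d₂))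
      ((c₁ ⊛ a₂) ⊕ (d₁ ⊛ c₂)) ((c₁ ⊛ b₂) ⊕ (d₁ ⊛ d₂))

I₂ : M2
I₂ = mat 1ps 0ps 0ps 1ps

A₀ A₁ A₀∞ A₁∞ : M2
A₀  = mat 1ps 0ps αps βps
A₁  = mat αps βps 0ps 1ps
A₀∞ = mat 1ps 0ps α/1-β 0ps
A₁∞ = mat 0ps β/1-α 0ps 1ps

-- ℕ̄₊ = {1,2,3,...} ∪ {∞};  fin1+ n represents the positive integer n+1
data ℕ̄₊ : Set where
  fin1+ : ℕ → ℕ̄₊
  ∞     : ℕ̄₊

pow1+ : M2 → ℕ → M2
pow1+ M zero    = M
pow1+ M (suc n) = M · pow1+ M n

A₀^ A₁^ : ℕ̄₊ → M2
A₀^ (fin1+ n) = pow1+ A₀ n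
A₀^ ∞         = A₀∞
A₁^ (fin1+ n) = pow1+ A₁ n
A₁^ ∞         = A₁∞

-- t = (k₀,ℓ₀,...,k_{N-1},ℓ_{N-1}) as a vector of pairs (k_j , ℓ_j)
word : ∀ {N} → Vec (ℕ̄₊ × ℕ̄₊) N → M2
word []             = I₂
word ((k , ℓ) ∷ ts) = (A₁^ k · A₀^ ℓ) · word ts

γ : ∀ {N} → Vec (ℕ̄₊ × ℕ̄₊) N → PS
γ t = a (word t)

cPartial : ∀ {N} → Vec (ℕ̄₊ × ℕ̄₊) N → ℕ → ℚ
cPartial t M = sumTo M λ i → sumTo i λ j → (½ ^ℚ (i ℕ.+ j)) * γ t i j

-- c_t = v : the series Σ_{i≥j≥0} 2^{-(i+j)} [α^i β^j] γ_t converges to v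
cEq : ∀ {N} → Vec (ℕ̄₊ × ℕ̄₊) N → ℚ → Set
cEq t v = ∀ (ε : ℚ) → 0ℚ < ε → ∃[ M₀ ] ∀ M → M₀ ≤ M → ∣ cPartial t M - v ∣ < ε

tOneInf : (N : ℕ) → Vec (ℕ̄₊ × ℕ̄₊) N
tOneInf N = replicate N (fin1+ 0 , ∞)

-- Since A₁ A₀∞ has first row (α/(1-β), 0), γ_t = (α/(1-β))^N, whose only nonzero
-- coefficients are [α^N β^j] = C(N+j-1, j).  Hence the partial sums of c_t are constant
-- from M = N on, equal to Σ_{j≤N} 2^{-(N+j)} C(N-1+j, j).  The terms j < N sum to 1/2,
-- because Σ_{j≤n} 2^{n-j} C(n+j, j) = 4^n, and the term j = N is C(2N-1, N)/4^N.
module Submission where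

open import Defs
open import Data.Nat using (ℕ; _≤_; _∸_) renaming (_+_ to _+ℕ_)
open import Data.Nat.Combinatorics using (_C_)
open import Data.Integer using (+_)
open import Data.Rational using (½; _+_; _*_; _/_)

open import Data.Nat as ℕ using (zero; suc; z≤n; s≤s)
import Data.Nat.Properties as ℕ
import Data.Nat.Combinatorics as ℕ
import Data.Nat.Solver as ℕ-Solver
import Data.Integer as ℤ
import Data.Integer.Properties as ℤ
import Data.Nat.Coprimality as Coprime
open import Data.Rational using (ℚ; 0ℚ; 1ℚ; _-_; ∣_∣; _<_; mkℚ)
import Data.Rational.Properties as ℚ
import Data.Rational.Solver as ℚ-Solver
open import Data.Product using (_×_; _,_)
open import Data.Vec using (Vec)
open import Data.Empty using (⊥-elim)
open import Relation.Nullary using (¬_; yes; no)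
open import Function using (_∘_)
open import Relation.Binary.PropositionalEquality

fromℕ : ℕ → ℚ
fromℕ n = + n / 1

fromℕ-normalised : ∀ n → fromℕ n ≡ mkℚ (+ n) 0 (Coprime.sym (Coprime.1-coprimeTo n))
fromℕ-normalised n = ℚ.normalize-coprime _

fromℕ-homo-+ : ∀ m n → fromℕ (m +ℕ n) ≡ fromℕ m + fromℕ n
fromℕ-homo-+ m n = sym (begin
  fromℕ m + fromℕ n                  ≡⟨ cong₂ _+_ (fromℕ-normalised m) (fromℕ-normalised n) ⟩
  (+ m ℤ.* + 1 ℤ.+ + n ℤ.* + 1) / 1  ≡⟨ cong₂ (λ x y → (x ℤ.+ y) / 1) (ℤ.*-identityʳ (+ m)) (ℤ.*-identityʳ (+ n)) ⟩
  fromℕ (m +ℕ n)                     ∎)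
  where open ≡-Reasoning

fromℕ-homo-* : ∀ m n → fromℕ (m ℕ.* n) ≡ fromℕ m * fromℕ n
fromℕ-homo-* m n = sym (begin
  fromℕ m * fromℕ n    ≡⟨ cong₂ _*_ (fromℕ-normalised m) (fromℕ-normalised n) ⟩
  (+ m ℤ.* + n) / 1    ≡⟨ cong (_/ 1) (sym (ℤ.pos-* m n)) ⟩
  fromℕ (m ℕ.* n)      ∎)
  where open ≡-Reasoning

^ℚ-double : ∀ p n → p ^ℚ (n +ℕ n) ≡ (p * p) ^ℚ n
^ℚ-double p zero    = refl
^ℚ-double p (suc n) = begin
  p * p ^ℚ (n +ℕ suc n)    ≡⟨ cong (λ k → p * p ^ℚ k) (ℕ.+-suc n n) ⟩
  p * (p * p ^ℚ (n +ℕ n))  ≡⟨ sym (ℚ.*-assoc p p _) ⟩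
  (p * p) * p ^ℚ (n +ℕ n)  ≡⟨ cong ((p * p) *_) (^ℚ-double p n) ⟩
  (p * p) * (p * p) ^ℚ n   ∎
  where open ≡-Reasoning

^ℚ-inverse : ∀ p m → p * fromℕ m ≡ 1ℚ → ∀ n → p ^ℚ n * fromℕ (m ℕ.^ n) ≡ 1ℚ
^ℚ-inverse p m pm≡1 zero    = refl
^ℚ-inverse p m pm≡1 (suc n) = begin
  (p * p ^ℚ n) * fromℕ (m ℕ.* m ℕ.^ n)         ≡⟨ cong ((p * p ^ℚ n) *_) (fromℕ-homo-* m (m ℕ.^ n)) ⟩
  (p * p ^ℚ n) * (fromℕ m * fromℕ (m ℕ.^ n))   ≡⟨ interchange p (p ^ℚ n) (fromℕ m) (fromℕ (m ℕ.^ n)) ⟩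
  (p * fromℕ m) * (p ^ℚ n * fromℕ (m ℕ.^ n))   ≡⟨ cong₂ _*_ pm≡1 (^ℚ-inverse p m pm≡1 n) ⟩
  1ℚ                                           ∎
  where
  open ≡-Reasoning
  interchange : ∀ w x y z → (w * x) * (y * z) ≡ (w * y) * (x * z)
  interchange = solve 4 (λ w x y z → (w :* x) :* (y :* z) := (w :* y) :* (x :* z)) refl
    where open ℚ-Solver.+-*-Solver

sumTo-cong : ∀ n {f g : ℕ → ℚ} → (∀ k → f k ≡ g k) → sumTo n f ≡ sumTo n g
sumTo-cong zero    f≡g = f≡g 0
sumTo-cong (suc n) f≡g = cong₂ _+_ (sumTo-cong n f≡g) (f≡g (suc n))

sumTo-zero : ∀ n {f : ℕ → ℚ} → (∀ k → k ≤ n → f k ≡ 0ℚ) → sumTo n f ≡ 0ℚ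
sumTo-zero zero    f≡0 = f≡0 0 z≤n
sumTo-zero (suc n) f≡0 = trans
  (cong₂ _+_ (sumTo-zero n (λ k k≤n → f≡0 k (ℕ.m≤n⇒m≤1+n k≤n))) (f≡0 (suc n) ℕ.≤-refl))
  (ℚ.+-identityʳ 0ℚ)

sumTo-single : ∀ n k {f : ℕ → ℚ} → k ≤ n → (∀ x → ¬ x ≡ k → f x ≡ 0ℚ) → sumTo n f ≡ f k
sumTo-single zero    .zero z≤n f≡0 = refl
sumTo-single (suc n) k {f} k≤1+n f≡0 with k ℕ.≟ suc n
... | yes refl = trans
  (cong (_+ f (suc n)) (sumTo-zero n (λ x x≤n → f≡0 x (λ { refl → ℕ.<-irrefl refl (s≤s x≤n) }))))
  (ℚ.+-identityˡ _)
... | no k≢1+n = trans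
  (cong₂ _+_ (sumTo-single n k (ℕ.≤-pred (ℕ.≤∧≢⇒< k≤1+n k≢1+n)) f≡0) (f≡0 (suc n) (k≢1+n ∘ sym)))
  (ℚ.+-identityʳ _)

sumTo-suc : ∀ n (f : ℕ → ℚ) → sumTo (suc n) f ≡ f 0 + sumTo n (λ k → f (suc k))
sumTo-suc zero    f = refl
sumTo-suc (suc n) f = trans (cong (_+ f (suc (suc n))) (sumTo-suc n f)) (ℚ.+-assoc (f 0) _ _)

sumTo-reverse : ∀ n (f : ℕ → ℚ) → sumTo n (λ k → f (n ∸ k)) ≡ sumTo n f
sumTo-reverse zero    f = refl
sumTo-reverse (suc n) f = begin
  sumTo (suc n) (λ k → f (suc n ∸ k))   ≡⟨ sumTo-suc n (λ k → f (suc n ∸ k)) ⟩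
  f (suc n) + sumTo n (λ k → f (n ∸ k))  ≡⟨ cong (λ s → f (suc n) + s) (sumTo-reverse n f) ⟩
  f (suc n) + sumTo n f                  ≡⟨ ℚ.+-comm (f (suc n)) (sumTo n f) ⟩
  sumTo n f + f (suc n)                  ∎
  where open ≡-Reasoning

sumTo-negBinomial : ∀ N j → sumTo j (λ k → fromℕ ((N +ℕ k ∸ 1) C k)) ≡ fromℕ ((N +ℕ j) C j)
sumTo-negBinomial N zero    = refl
sumTo-negBinomial N (suc j) = begin
  sumTo j (λ k → fromℕ ((N +ℕ k ∸ 1) C k)) + fromℕ ((N +ℕ suc j ∸ 1) C suc j)
    ≡⟨ cong₂ _+_ (sumTo-negBinomial N j) (cong (λ n → fromℕ ((n ∸ 1) C suc j)) (ℕ.+-suc N j)) ⟩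
  fromℕ ((N +ℕ j) C j) + fromℕ ((N +ℕ j) C suc j)
    ≡⟨ sym (fromℕ-homo-+ ((N +ℕ j) C j) ((N +ℕ j) C suc j)) ⟩
  fromℕ ((N +ℕ j) C j +ℕ (N +ℕ j) C suc j)
    ≡⟨ cong fromℕ (ℕ.nCk+nC[k+1]≡[n+1]C[k+1] (N +ℕ j) j) ⟩
  fromℕ (suc (N +ℕ j) C suc j)
    ≡⟨ cong (λ n → fromℕ (n C suc j)) (sym (ℕ.+-suc N j)) ⟩
  fromℕ ((N +ℕ suc j) C suc j)
    ∎
  where open ≡-Reasoning

⊛-congˡ : ∀ {f f′ : PS} g → (∀ a b → f a b ≡ f′ a b) → ∀ i j → (f ⊛ g) i j ≡ (f′ ⊛ g) i j
⊛-congˡ g f≡f′ i j =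
  sumTo-cong i (λ a → sumTo-cong j (λ b → cong (_* g (i ∸ a) (j ∸ b)) (f≡f′ a b)))

⊛-zeroˡ : ∀ {f : PS} g → (∀ a b → f a b ≡ 0ℚ) → ∀ i j → (f ⊛ g) i j ≡ 0ℚ
⊛-zeroˡ g f≡0 i j = sumTo-zero i (λ a _ → sumTo-zero j (λ b _ →
  trans (cong (_* g (i ∸ a) (j ∸ b)) (f≡0 a b)) (ℚ.*-zeroˡ (g (i ∸ a) (j ∸ b)))))

⊛-zeroʳ : ∀ f i j → (f ⊛ 0ps) i j ≡ 0ℚ
⊛-zeroʳ f i j = sumTo-zero i (λ a _ → sumTo-zero j (λ b _ → ℚ.*-zeroʳ (f a b)))

αDegreeOne : PS → Set
αDegreeOne f = ∀ a b → ¬ a ≡ 1 → f a b ≡ 0ℚ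

αDegreeOne-⊛-zero : ∀ {f} → αDegreeOne f → ∀ g j → (f ⊛ g) 0 j ≡ 0ℚ
αDegreeOne-⊛-zero f₁ g j = sumTo-zero j (λ b _ →
  trans (cong (_* g 0 (j ∸ b)) (f₁ 0 b (λ ()))) (ℚ.*-zeroˡ (g 0 (j ∸ b))))

αDegreeOne-⊛-suc : ∀ {f} → αDegreeOne f → ∀ g i j →
  (f ⊛ g) (suc i) j ≡ sumTo j (λ b → f 1 b * g i (j ∸ b))
αDegreeOne-⊛-suc {f} f₁ g i j = sumTo-single (suc i) 1 (s≤s z≤n) (λ a a≢1 → sumTo-zero j (λ b _ →
  trans (cong (_* g (suc i ∸ a) (j ∸ b)) (f₁ a b a≢1)) (ℚ.*-zeroˡ (g (suc i ∸ a) (j ∸ b)))))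

αps-αDegreeOne : αDegreeOne αps
αps-αDegreeOne zero          b a≢1 = refl
αps-αDegreeOne (suc zero)    b a≢1 = ⊥-elim (a≢1 refl)
αps-αDegreeOne (suc (suc a)) b a≢1 = refl

α/1-β-αDegreeOne : αDegreeOne α/1-β
α/1-β-αDegreeOne zero          b a≢1 = refl
α/1-β-αDegreeOne (suc zero)    b a≢1 = ⊥-elim (a≢1 refl)
α/1-β-αDegreeOne (suc (suc a)) b a≢1 = refl

αps-⊛-suc : ∀ g i j → (αps ⊛ g) (suc i) j ≡ g i j
αps-⊛-suc g i j = begin
  (αps ⊛ g) (suc i) j                      ≡⟨ αDegreeOne-⊛-suc αps-αDegreeOne g i j ⟩
  sumTo j (λ b → αps 1 b * g i (j ∸ b))    ≡⟨ sumTo-single j 0 z≤n αps₁ ⟩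
  1ℚ * g i j                               ≡⟨ ℚ.*-identityˡ (g i j) ⟩
  g i j                                    ∎
  where
  open ≡-Reasoning
  αps₁ : ∀ b → ¬ b ≡ 0 → αps 1 b * g i (j ∸ b) ≡ 0ℚ
  αps₁ zero    b≢0 = ⊥-elim (b≢0 refl)
  αps₁ (suc b) b≢0 = ℚ.*-zeroˡ (g i (j ∸ suc b))

α/1-β-⊛-suc : ∀ g i j → (α/1-β ⊛ g) (suc i) j ≡ sumTo j (λ b → g i (j ∸ b))
α/1-β-⊛-suc g i j = trans (αDegreeOne-⊛-suc α/1-β-αDegreeOne g i j)
                          (sumTo-cong j (λ b → ℚ.*-identityˡ (g i (j ∸ b))))

βps-⊛-zero : ∀ g i → (βps ⊛ g) i 0 ≡ 0ℚ
βps-⊛-zero g i = sumTo-zero i (λ a _ → trans (cong (_* g (i ∸ a) 0) (βps-at-0 a)) (ℚ.*-zeroˡ (g (i ∸ a) 0)))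
  where
  βps-at-0 : ∀ a → βps a 0 ≡ 0ℚ
  βps-at-0 zero    = refl
  βps-at-0 (suc a) = refl

βps-⊛-suc : ∀ g i j → (βps ⊛ g) i (suc j) ≡ g i j
βps-⊛-suc g i j = begin
  (βps ⊛ g) i (suc j)                                 ≡⟨ sumTo-single i 0 z≤n βps-row ⟩
  sumTo (suc j) (λ b → βps 0 b * g i (suc j ∸ b))     ≡⟨ sumTo-single (suc j) 1 (s≤s z≤n) βps₀ ⟩
  1ℚ * g i j                                          ≡⟨ ℚ.*-identityˡ (g i j) ⟩
  g i j                                               ∎
  where
  open ≡-Reasoning
  βps-row : ∀ a → ¬ a ≡ 0 → sumTo (suc j) (λ b → βps a b * g (i ∸ a) (suc j ∸ b)) ≡ 0ℚ
  βps-row zero    a≢0 = ⊥-elim (a≢0 refl)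
  βps-row (suc a) a≢0 = sumTo-zero (suc j) (λ b _ → ℚ.*-zeroˡ (g (i ∸ suc a) (suc j ∸ b)))
  βps₀ : ∀ b → ¬ b ≡ 1 → βps 0 b * g i (suc j ∸ b) ≡ 0ℚ
  βps₀ zero          b≢1 = ℚ.*-zeroˡ (g i (suc j))
  βps₀ (suc zero)    b≢1 = ⊥-elim (b≢1 refl)
  βps₀ (suc (suc b)) b≢1 = ℚ.*-zeroˡ (g i (suc j ∸ suc (suc b)))

-- α + β · α/(1-β) = α/(1-β)
a-A₁·A₀∞ : ∀ i j → a (A₁ · A₀∞) i j ≡ α/1-β i j
a-A₁·A₀∞ zero zero                = cong₂ _+_ (αDegreeOne-⊛-zero αps-αDegreeOne 1ps 0) (βps-⊛-zero α/1-β 0)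
a-A₁·A₀∞ zero (suc j)             = cong₂ _+_ (αDegreeOne-⊛-zero αps-αDegreeOne 1ps (suc j)) (βps-⊛-suc α/1-β 0 j)
a-A₁·A₀∞ (suc zero) zero          = trans (cong₂ _+_ (αps-⊛-suc 1ps 0 0) (βps-⊛-zero α/1-β 1)) (ℚ.+-identityʳ 1ℚ)
a-A₁·A₀∞ (suc (suc i)) zero       = cong₂ _+_ (αps-⊛-suc 1ps (suc i) 0) (βps-⊛-zero α/1-β (suc (suc i)))
a-A₁·A₀∞ (suc zero) (suc j)       = trans (cong₂ _+_ (αps-⊛-suc 1ps 0 (suc j)) (βps-⊛-suc α/1-β 1 j)) (ℚ.+-identityˡ 1ℚ)
a-A₁·A₀∞ (suc (suc i)) (suc j)    = cong₂ _+_ (αps-⊛-suc 1ps (suc i) (suc j)) (βps-⊛-suc α/1-β (suc (suc i)) j)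

b-A₁·A₀∞ : ∀ i j → b (A₁ · A₀∞) i j ≡ 0ℚ
b-A₁·A₀∞ i j = cong₂ _+_ (⊛-zeroʳ αps i j) (⊛-zeroʳ βps i j)

a-·-of-b≡0 : ∀ M P {f : PS} → (∀ i j → a M i j ≡ f i j) → (∀ i j → b M i j ≡ 0ℚ) →
  ∀ i j → a (M · P) i j ≡ (f ⊛ a P) i j
a-·-of-b≡0 M P aM≡f bM≡0 i j = trans
  (cong₂ _+_ (⊛-congˡ (a P) aM≡f i j) (⊛-zeroˡ (c P) bM≡0 i j))
  (ℚ.+-identityʳ _)

γ-tOneInf-suc : ∀ N i j → γ (tOneInf (suc N)) i j ≡ (α/1-β ⊛ γ (tOneInf N)) i j
γ-tOneInf-suc N = a-·-of-b≡0 (A₁ · A₀∞) (word (tOneInf N)) a-A₁·A₀∞ b-A₁·A₀∞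

γ-tOneInf-diagonal : ∀ N j → γ (tOneInf N) N j ≡ fromℕ ((N +ℕ j ∸ 1) C j)
γ-tOneInf-diagonal zero    zero    = refl
γ-tOneInf-diagonal zero    (suc j) = cong fromℕ (sym (ℕ.k>n⇒nCk≡0 (ℕ.n<1+n j)))
γ-tOneInf-diagonal (suc N) j       = begin
  γ (tOneInf (suc N)) (suc N) j                     ≡⟨ γ-tOneInf-suc N (suc N) j ⟩
  (α/1-β ⊛ γ (tOneInf N)) (suc N) j                 ≡⟨ α/1-β-⊛-suc (γ (tOneInf N)) N j ⟩
  sumTo j (λ k → γ (tOneInf N) N (j ∸ k))           ≡⟨ sumTo-cong j (λ k → γ-tOneInf-diagonal N (j ∸ k)) ⟩
  sumTo j (λ k → fromℕ ((N +ℕ (j ∸ k) ∸ 1) C (j ∸ k)))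
                                                    ≡⟨ sumTo-reverse j (λ k → fromℕ ((N +ℕ k ∸ 1) C k)) ⟩
  sumTo j (λ k → fromℕ ((N +ℕ k ∸ 1) C k))          ≡⟨ sumTo-negBinomial N j ⟩
  fromℕ ((N +ℕ j) C j)                              ∎
  where open ≡-Reasoning

γ-tOneInf-offDiagonal : ∀ N i j → ¬ i ≡ N → γ (tOneInf N) i j ≡ 0ℚ
γ-tOneInf-offDiagonal zero    zero    j i≢N = ⊥-elim (i≢N refl)
γ-tOneInf-offDiagonal zero    (suc i) j i≢N = refl
γ-tOneInf-offDiagonal (suc N) zero    j i≢N =
  trans (γ-tOneInf-suc N 0 j) (αDegreeOne-⊛-zero α/1-β-αDegreeOne (γ (tOneInf N)) j)
γ-tOneInf-offDiagonal (suc N) (suc i) j i≢N =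
  trans (γ-tOneInf-suc N (suc i) j) (trans (α/1-β-⊛-suc (γ (tOneInf N)) i j)
    (sumTo-zero j (λ k _ → γ-tOneInf-offDiagonal N i (j ∸ k) (λ i≡N → i≢N (cong suc i≡N)))))

cPartial-tOneInf : ∀ {N M} → N ≤ M →
  cPartial (tOneInf N) M ≡ sumTo N (λ j → ½ ^ℚ (N +ℕ j) * fromℕ ((N +ℕ j ∸ 1) C j))
cPartial-tOneInf {N} {M} N≤M = trans
  (sumTo-single M N N≤M (λ i i≢N → sumTo-zero i (λ j _ →
    trans (cong (½ ^ℚ (i +ℕ j) *_) (γ-tOneInf-offDiagonal N i j i≢N)) (ℚ.*-zeroʳ (½ ^ℚ (i +ℕ j))))))
  (sumTo-cong N (λ j → cong (½ ^ℚ (N +ℕ j) *_) (γ-tOneInf-diagonal N j)))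

cEq-eventuallyConstant : ∀ {N} (t : Vec (ℕ̄₊ × ℕ̄₊) N) v M₀ →
  (∀ M → M₀ ≤ M → cPartial t M ≡ v) → cEq t v
cEq-eventuallyConstant t v M₀ constant ε 0<ε = M₀ , λ M M₀≤M →
  subst (_< ε) (sym (cong ∣_∣ (trans (cong (_- v) (constant M M₀≤M)) (ℚ.+-inverseʳ v)))) 0<ε

-- horner₂ c m = Σ_{j ≤ m} 2^(m-j) c j
horner₂ : (ℕ → ℕ) → ℕ → ℕ
horner₂ c zero    = c 0
horner₂ c (suc m) = 2 ℕ.* horner₂ c m +ℕ c (suc m)

sumTo-½^-horner₂ : ∀ K c m →
  sumTo m (λ j → ½ ^ℚ (K +ℕ j) * fromℕ (c j)) ≡ ½ ^ℚ (K +ℕ m) * fromℕ (horner₂ c m)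
sumTo-½^-horner₂ K c zero    = refl
sumTo-½^-horner₂ K c (suc m) = begin
  sumTo m (λ j → ½ ^ℚ (K +ℕ j) * fromℕ (c j)) + ½ ^ℚ (K +ℕ suc m) * fromℕ (c (suc m))
    ≡⟨ cong₂ (λ s k → s + ½ ^ℚ k * fromℕ (c (suc m))) (sumTo-½^-horner₂ K c m) (ℕ.+-suc K m) ⟩
  P * fromℕ h + (½ * P) * fromℕ (c (suc m))
    ≡⟨ halve ½ P (fromℕ h) (fromℕ (c (suc m))) refl ⟩
  (½ * P) * (fromℕ 2 * fromℕ h + fromℕ (c (suc m)))
    ≡⟨ cong₂ (λ k x → ½ ^ℚ k * x) (sym (ℕ.+-suc K m))
             (sym (trans (fromℕ-homo-+ (2 ℕ.* h) (c (suc m))) (cong (_+ fromℕ (c (suc m))) (fromℕ-homo-* 2 h)))) ⟩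
  ½ ^ℚ (K +ℕ suc m) * fromℕ (horner₂ c (suc m))
    ∎
  where
  open ≡-Reasoning
  P = ½ ^ℚ (K +ℕ m)
  h = horner₂ c m
  halve : ∀ t P x y → t * fromℕ 2 ≡ 1ℚ → P * x + (t * P) * y ≡ (t * P) * (fromℕ 2 * x + y)
  halve t P x y t2≡1 = begin
    P * x + (t * P) * y                       ≡⟨ cong (_+ (t * P) * y) (sym (ℚ.*-identityˡ (P * x))) ⟩
    1ℚ * (P * x) + (t * P) * y                ≡⟨ cong (λ u → u * (P * x) + (t * P) * y) (sym t2≡1) ⟩
    (t * fromℕ 2) * (P * x) + (t * P) * y     ≡⟨ solve 5 (λ t P x y two →
                                                   (t :* two) :* (P :* x) :+ (t :* P) :* y
                                                   := (t :* P) :* (two :* x :+ y)) refl t P x y (fromℕ 2) ⟩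
    (t * P) * (fromℕ 2 * x + y)               ∎
    where open ℚ-Solver.+-*-Solver

weightedBinomialSum : ℕ → ℕ → ℕ
weightedBinomialSum n = horner₂ (λ j → (n +ℕ j) C j)

weightedBinomialSum-suc : ∀ n m →
  weightedBinomialSum (suc n) m +ℕ (suc n +ℕ m) C m ≡ 2 ℕ.* weightedBinomialSum n m
weightedBinomialSum-suc n zero    = refl
weightedBinomialSum-suc n (suc m) = begin
  (2 ℕ.* x +ℕ A) +ℕ A
    ≡⟨ cong (λ z → (2 ℕ.* x +ℕ z) +ℕ z) (sym (ℕ.nCk+nC[k+1]≡[n+1]C[k+1] P m)) ⟩
  (2 ℕ.* x +ℕ (P C m +ℕ P C suc m)) +ℕ (P C m +ℕ P C suc m)
    ≡⟨ solve 3 (λ x y z → (con 2 :* x :+ (y :+ z)) :+ (y :+ z) := con 2 :* ((x :+ y) :+ z))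
             refl x (P C m) (P C suc m) ⟩
  2 ℕ.* ((x +ℕ P C m) +ℕ P C suc m)
    ≡⟨ cong (λ z → 2 ℕ.* (z +ℕ P C suc m)) ih ⟩
  2 ℕ.* (2 ℕ.* weightedBinomialSum n m +ℕ P C suc m)
    ∎
  where
  open ≡-Reasoning
  open ℕ-Solver.+-*-Solver
  P = n +ℕ suc m
  x = weightedBinomialSum (suc n) m
  A = suc P C suc m
  ih : x +ℕ P C m ≡ 2 ℕ.* weightedBinomialSum n m
  ih = trans (cong (λ k → x +ℕ k C m) (ℕ.+-suc n m)) (weightedBinomialSum-suc n m)

weightedBinomialSum-diagonal : ∀ n → weightedBinomialSum n n ≡ 4 ℕ.^ n
weightedBinomialSum-diagonal zero    = refl
weightedBinomialSum-diagonal (suc n) = begin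
  2 ℕ.* x +ℕ suc P C suc n
    ≡⟨ cong (2 ℕ.* x +ℕ_) (sym (ℕ.nCk+nC[k+1]≡[n+1]C[k+1] P n)) ⟩
  2 ℕ.* x +ℕ (P C n +ℕ P C suc n)
    ≡⟨ cong (λ z → 2 ℕ.* x +ℕ (P C n +ℕ z)) (sym symmetric) ⟩
  2 ℕ.* x +ℕ (P C n +ℕ P C n)
    ≡⟨ solve 2 (λ x y → con 2 :* x :+ (y :+ y) := con 2 :* (x :+ y)) refl x (P C n) ⟩
  2 ℕ.* (x +ℕ P C n)
    ≡⟨ cong (2 ℕ.*_) (trans (cong (λ k → x +ℕ k C n) (ℕ.+-suc n n)) (weightedBinomialSum-suc n n)) ⟩
  2 ℕ.* (2 ℕ.* weightedBinomialSum n n)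
    ≡⟨ cong (λ z → 2 ℕ.* (2 ℕ.* z)) (weightedBinomialSum-diagonal n) ⟩
  2 ℕ.* (2 ℕ.* 4 ℕ.^ n)
    ≡⟨ solve 1 (λ y → con 2 :* (con 2 :* y) := con 4 :* y) refl (4 ℕ.^ n) ⟩
  4 ℕ.* 4 ℕ.^ n
    ∎
  where
  open ≡-Reasoning
  open ℕ-Solver.+-*-Solver
  P = n +ℕ suc n
  x = weightedBinomialSum (suc n) n
  symmetric : P C n ≡ P C suc n
  symmetric = trans (ℕ.nCk≡nC[n∸k] (ℕ.m≤m+n n (suc n))) (cong (P C_) (ℕ.m+n∸m≡n n (suc n)))

halfWeightedBinomialSum : ∀ n →
  sumTo (suc n) (λ j → ½ ^ℚ (suc n +ℕ j) * fromℕ ((n +ℕ j) C j))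
    ≡ ½ + fromℕ ((n +ℕ suc n) C suc n) * (+ 1 / 4) ^ℚ suc n
halfWeightedBinomialSum n = cong₂ _+_ initialTerms lastTerm
  where
  open ≡-Reasoning
  B = (n +ℕ suc n) C suc n
  initialTerms : sumTo n (λ j → ½ ^ℚ (suc n +ℕ j) * fromℕ ((n +ℕ j) C j)) ≡ ½
  initialTerms = begin
    sumTo n (λ j → ½ ^ℚ (suc n +ℕ j) * fromℕ ((n +ℕ j) C j))
      ≡⟨ sumTo-½^-horner₂ (suc n) (λ j → (n +ℕ j) C j) n ⟩
    (½ * ½ ^ℚ (n +ℕ n)) * fromℕ (weightedBinomialSum n n)
      ≡⟨ cong₂ (λ p m → (½ * p) * fromℕ m) (^ℚ-double ½ n) (weightedBinomialSum-diagonal n) ⟩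
    (½ * (+ 1 / 4) ^ℚ n) * fromℕ (4 ℕ.^ n)
      ≡⟨ ℚ.*-assoc ½ ((+ 1 / 4) ^ℚ n) (fromℕ (4 ℕ.^ n)) ⟩
    ½ * ((+ 1 / 4) ^ℚ n * fromℕ (4 ℕ.^ n))
      ≡⟨ cong (½ *_) (^ℚ-inverse (+ 1 / 4) 4 refl n) ⟩
    ½ * 1ℚ
      ≡⟨ ℚ.*-identityʳ ½ ⟩
    ½ ∎
  lastTerm : ½ ^ℚ (suc n +ℕ suc n) * fromℕ B ≡ fromℕ B * (+ 1 / 4) ^ℚ suc n
  lastTerm = trans (cong (_* fromℕ B) (^ℚ-double ½ (suc n))) (ℚ.*-comm ((+ 1 / 4) ^ℚ suc n) (fromℕ B))

proposition6p9 : (N : ℕ) → 1 ≤ N →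
    cEq (tOneInf N) (½ + (+ ((N +ℕ N ∸ 1) C N) / 1) * ((+ 1 / 4) ^ℚ N))
proposition6p9 zero    ()
proposition6p9 (suc n) _ = cEq-eventuallyConstant (tOneInf (suc n)) _ (suc n)
  (λ M 1+n≤M → trans (cPartial-tOneInf 1+n≤M) (halfWeightedBinomialSum n))
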